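{- Let $\Delta$ be a filter and $Q$, $Q'$ be two queries. Then $Q$ is $\Delta$-more general than $Q'$ if and only if there exists a substitution $\eta$ such that $Var(\eta)\subseteq Var(Q,Q')$ and $Q$ is $\Delta$-more general than $Q'$ for $\eta$.
   Context: Fix a first-order language $\mathcal L$; $\Pi$ is its set of relation symbols, each $p$ with unique arity $arity(p)$; $TU_{\mathcal L}$ is the set of all terms. A query is a finite sequence of atoms. $Var(E)$ is the set of variables occurring in $E$; $Var(Q,Q')$ is the set of variables occurring in $Q$ or $Q'$; for a substitution $\eta$, $Var(\eta)=Dom(\eta)\cup Ran(\eta)$, where $Ran(\eta)$ is the set of variables in the terms $x\eta$, $x\in Dom(\eta)$. A term-condition is a map $TU_{\mathcal L}\to\{\mathtt{true},\mathtt{false}\}$. A filter $\Delta$ assigns to each $p\in\Pi$ a partial function $\Delta(p)$ from $\{1,\dots,arity(p)\}$ to term-conditions. For a substitution $\eta$, an atom $A=p(s_1,\dots,s_n)$ is $\Delta$-more general than an atom $B$ for $\eta$ if $B=p(t_1,\dots,t_n)$, $t_i=s_i\eta$ for all $i\notin Dom(\Delta(p))$, and $\Delta(p)(i)(s_i)=\mathtt{true}$ for all $i\in Dom(\Delta(p))$. A query $A_1,\dots,A_n$ is $\Delta$-more general than $B_1,\dots,B_m$ for $\eta$ if $n=m$ and each $A_i$ is $\Delta$-more general than $B_i$ for $\eta$; $Q$ is $\Delta$-more general than $Q'$ if this holds for some substitution $\eta$. -}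

module Defs where

open import Data.Nat using (ℕ; _≟_)
open import Data.Bool using (Bool; true)
open import Data.Fin using (Fin)
open import Data.Vec using (Vec; lookup; []; _∷_)
open import Data.List using (List; map)
open import Data.List.Membership.Propositional using (_∈_)
open import Data.List.Relation.Unary.Unique.Propositional using (Unique)
open import Data.List.Relation.Unary.All using (All)
open import Data.List.Relation.Unary.Any using (Any)
open import Data.List.Relation.Binary.Pointwise using (Pointwise)
open import Data.Maybe using (Maybe; just; nothing)
open import Data.Product using (_×_; _,_; proj₁; proj₂; ∃)
open import Data.Sum using (_⊎_)
open import Relation.Nullary using (¬_; yes; no)
open import Relation.Binary.PropositionalEquality using (_≡_)

record Language : Set₁ where
  field
    Fun   : Set
    funAr : Fun → ℕ
    Rel   : Set
    arity : Rel → ℕ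

module _ (L : Language) where
  open Language L

  data Term : Set where
    var : ℕ → Term
    app : (f : Fun) → Vec Term (funAr f) → Term

  data _occursIn_ (x : ℕ) : Term → Set where
    here : x occursIn var x
    arg  : ∀ {f ts} (i : Fin (funAr f)) → x occursIn lookup ts i → x occursIn app f ts

  record Subst : Set where
    constructor subst
    field
      bindings : List (ℕ × Term)
      distinct : Unique (map proj₁ bindings)
      nontriv  : All (λ b → ¬ (proj₂ b ≡ var (proj₁ b))) bindings

  lookupB : List (ℕ × Term) → ℕ → Term
  lookupB List.[] x = var x
  lookupB ((y , t) List.∷ bs) x with x ≟ y
  ... | yes _ = t
  ... | no  _ = lookupB bs x

  mutual
    _·_ : Term → Subst → Term
    var x · η = lookupB (Subst.bindings η) x
    app f ts · η = app f (applyVec ts η)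

    applyVec : ∀ {n} → Vec Term n → Subst → Vec Term n
    applyVec [] η = []
    applyVec (t ∷ ts) η = (t · η) ∷ applyVec ts η

  inDom : ℕ → Subst → Set
  inDom x η = x ∈ map proj₁ (Subst.bindings η)

  inRan : ℕ → Subst → Set
  inRan x η = Any (λ b → x occursIn proj₂ b) (Subst.bindings η)

  inVarSubst : ℕ → Subst → Set
  inVarSubst x η = inDom x η ⊎ inRan x η

  record Atom : Set where
    constructor atom
    field
      rel  : Rel
      args : Vec Term (arity rel)

  Query : Set
  Query = List Atom

  inVarAtom : ℕ → Atom → Set
  inVarAtom x (atom p ss) = ∃ λ (i : Fin (arity p)) → x occursIn lookup ss i

  inVarQuery : ℕ → Query → Set
  inVarQuery x Q = Any (inVarAtom x) Q

  TermCondition : Set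
  TermCondition = Term → Bool

  Filter : Set
  Filter = (p : Rel) → Fin (arity p) → Maybe TermCondition

  PosCond : Maybe TermCondition → Term → Term → Subst → Set
  PosCond nothing  s t η = t ≡ s · η
  PosCond (just c) s t η = c s ≡ true

  data AtomMoreGeneralFor (Δ : Filter) (η : Subst) : Atom → Atom → Set where
    mg : ∀ {p ss ts} →
         (∀ (i : Fin (arity p)) → PosCond (Δ p i) (lookup ss i) (lookup ts i) η) →
         AtomMoreGeneralFor Δ η (atom p ss) (atom p ts)

  QueryMoreGeneralFor : Filter → Subst → Query → Query → Set
  QueryMoreGeneralFor Δ η Q Q' = Pointwise (AtomMoreGeneralFor Δ η) Q Q'

  QueryMoreGeneral : Filter → Query → Query → Set
  QueryMoreGeneral Δ Q Q' = ∃ λ η → QueryMoreGeneralFor Δ η Q Q'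

-- Only the unfiltered argument positions of Q constrain η, and they only
-- involve the variables of Q occurring at such positions. Restricting η to
-- these variables therefore keeps Q Δ-more general than Q'; the domain of the
-- restriction lies in Var(Q), and every variable of its range occurs in some
-- s η with s an unfiltered argument of Q, i.e. in the corresponding argument
-- of Q'.
module Submission where

open import Defs hiding (subst)
open import Data.Product using (Σ; _×_; _,_; proj₁; ∃-syntax)
open import Data.Sum using (_⊎_; inj₁; inj₂)
open import Function using (_∘_)
open import Function.Bundles using (_⇔_; mk⇔)
open import Data.Nat using (ℕ; _≟_)
open import Data.Fin using (Fin; zero; suc)
import Data.Fin.Properties as Fin
open import Data.Vec using (Vec; lookup; []; _∷_)
open import Data.List using (List; []; _∷_; map; filter)
open import Data.List.Membership.Propositional using (_∈_; find)
open import Data.List.Membership.Propositional.Properties using (∈-map⁺; ∈-filter⁻; ∈-map∘filter⁻)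
import Data.List.Relation.Unary.All as All
import Data.List.Relation.Unary.All.Properties as All
open import Data.List.Relation.Unary.Any as Any using (Any; here; there)
import Data.List.Relation.Unary.AllPairs.Properties as AllPairs
open import Data.List.Relation.Unary.AllPairs using ([]; _∷_)
open import Data.List.Relation.Unary.Unique.Propositional using (Unique)
open import Data.List.Relation.Binary.Pointwise using ([]; _∷_)
open import Data.Maybe using (Maybe; just; nothing)
open import Data.Empty using (⊥-elim)
open import Relation.Nullary using (¬_; Dec; yes; no)
open import Relation.Nullary.Decidable using (_×-dec_)
open import Relation.Unary using (Decidable)
open import Relation.Binary.PropositionalEquality
  using (_≡_; refl; sym; trans; cong; cong₂; subst)

nothing? : {A : Set} (m : Maybe A) → Dec (m ≡ nothing)
nothing? nothing  = yes refl
nothing? (just _) = no λ ()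

module _ {L : Language} where

  private
    _∈ᵥ_ : ℕ → Term L → Set
    x ∈ᵥ t = _occursIn_ L x t

    _∙_ : Term L → Subst L → Term L
    t ∙ η = _·_ L t η

    lookupᵇ : List (ℕ × Term L) → ℕ → Term L
    lookupᵇ = lookupB L

  mutual
    occursIn? : (x : ℕ) (t : Term L) → Dec (x ∈ᵥ t)
    occursIn? x (var y) with x ≟ y
    ... | yes refl = yes here
    ... | no x≢y   = no λ { here → x≢y refl }
    occursIn? x (app f ts) with occursIn-lookup? x ts
    ... | yes (i , x∈tᵢ) = yes (arg i x∈tᵢ)
    ... | no  x∉ts       = no λ { (arg i x∈tᵢ) → x∉ts (i , x∈tᵢ) }

    occursIn-lookup? : ∀ {n} (x : ℕ) (ts : Vec (Term L) n) →
                       Dec (∃[ i ] x ∈ᵥ lookup ts i)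
    occursIn-lookup? x [] = no λ { (() , _) }
    occursIn-lookup? x (t ∷ ts) with occursIn? x t | occursIn-lookup? x ts
    ... | yes x∈t | _              = yes (zero , x∈t)
    ... | no _    | yes (i , x∈tᵢ) = yes (suc i , x∈tᵢ)
    ... | no x∉t  | no x∉ts        =
      no λ { (zero , x∈t) → x∉t x∈t ; (suc i , x∈tᵢ) → x∉ts (i , x∈tᵢ) }

  lookup-applyVec : ∀ {n} (ts : Vec (Term L) n) (η : Subst L) (i : Fin n) →
                    lookup (applyVec L ts η) i ≡ lookup ts i ∙ η
  lookup-applyVec (t ∷ ts) η zero    = refl
  lookup-applyVec (t ∷ ts) η (suc i) = lookup-applyVec ts η i

  occursIn-∙ : ∀ {x y s} (η : Subst L) → y ∈ᵥ s → x ∈ᵥ (var y ∙ η) → x ∈ᵥ (s ∙ η)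
  occursIn-∙ η here x∈yη = x∈yη
  occursIn-∙ {x} η (arg {ts = ts} i y∈tᵢ) x∈yη =
    arg i (subst (x ∈ᵥ_) (sym (lookup-applyVec ts η i)) (occursIn-∙ η y∈tᵢ x∈yη))

  mutual
    ∙-cong : ∀ (η η′ : Subst L) (s : Term L) →
             (∀ y → y ∈ᵥ s → var y ∙ η′ ≡ var y ∙ η) → s ∙ η′ ≡ s ∙ η
    ∙-cong η η′ (var x)    agree = agree x here
    ∙-cong η η′ (app f ts) agree =
      cong (app f) (applyVec-cong η η′ ts λ i y y∈tᵢ → agree y (arg i y∈tᵢ))

    applyVec-cong : ∀ {n} (η η′ : Subst L) (ts : Vec (Term L) n) →
                    (∀ i y → y ∈ᵥ lookup ts i → var y ∙ η′ ≡ var y ∙ η) →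
                    applyVec L ts η′ ≡ applyVec L ts η
    applyVec-cong η η′ []       agree = refl
    applyVec-cong η η′ (t ∷ ts) agree =
      cong₂ _∷_ (∙-cong η η′ t (agree zero)) (applyVec-cong η η′ ts (agree ∘ suc))

  lookupB-here : ∀ y t bs → lookupᵇ ((y , t) ∷ bs) y ≡ t
  lookupB-here y t bs with y ≟ y
  ... | yes _   = refl
  ... | no y≢y = ⊥-elim (y≢y refl)

  lookupB-there : ∀ {x y} t bs → ¬ x ≡ y → lookupᵇ ((y , t) ∷ bs) x ≡ lookupᵇ bs x
  lookupB-there {x} {y} t bs x≢y with x ≟ y
  ... | yes x≡y = ⊥-elim (x≢y x≡y)
  ... | no _    = refl

  lookupB-∈ : ∀ {y t} bs → Unique (map proj₁ bs) → (y , t) ∈ bs → lookupᵇ bs y ≡ t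
  lookupB-∈ ((y , t) ∷ bs) _ (here refl) = lookupB-here y t bs
  lookupB-∈ ((y₀ , t₀) ∷ bs) (y₀∉bs ∷ bs!) (there y∈bs) =
    trans (lookupB-there t₀ bs (λ { refl → All.lookup y₀∉bs (∈-map⁺ proj₁ y∈bs) refl }))
          (lookupB-∈ bs bs! y∈bs)

  lookupB-filter : ∀ {P : ℕ → Set} (P? : Decidable P) {x} → P x → ∀ bs →
                   lookupᵇ (filter (P? ∘ proj₁) bs) x ≡ lookupᵇ bs x
  lookupB-filter P? Px [] = refl
  lookupB-filter P? {x} Px ((y , t) ∷ bs) with P? y
  ... | yes _ with x ≟ y
  ...   | yes _    = refl
  ...   | no _     = lookupB-filter P? Px bs
  lookupB-filter P? {x} Px ((y , t) ∷ bs) | no ¬Py with x ≟ y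
  ...   | yes refl = ⊥-elim (¬Py Px)
  ...   | no _     = lookupB-filter P? Px bs

  restrict : {P : ℕ → Set} → Decidable P → Subst L → Subst L
  restrict P? η = record
    { bindings = filter (P? ∘ proj₁) bindings
    ; distinct = AllPairs.map⁺ (AllPairs.filter⁺ (P? ∘ proj₁) (AllPairs.map⁻ distinct))
    ; nontriv  = All.filter⁺ (P? ∘ proj₁) nontriv
    }
    where open Subst η

  module _ {P : ℕ → Set} (P? : Decidable P) (η : Subst L) where

    restrict-agrees : ∀ {y} → P y → var y ∙ restrict P? η ≡ var y ∙ η
    restrict-agrees Py = lookupB-filter P? Py (Subst.bindings η)

    restrict-dom : ∀ {x} → inDom L x (restrict P? η) → P x
    restrict-dom x∈dom with ∈-map∘filter⁻ proj₁ (P? ∘ proj₁) {xs = Subst.bindings η} x∈dom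
    ... | _ , _ , refl , Px = Px

    restrict-ran : ∀ {x} → inRan L x (restrict P? η) → ∃[ y ] P y × x ∈ᵥ (var y ∙ η)
    restrict-ran {x} x∈ran with find x∈ran
    ... | (y , t) , yt∈filtered , x∈t with ∈-filter⁻ (P? ∘ proj₁) yt∈filtered
    ...   | yt∈η , Py = y , Py , subst (x ∈ᵥ_) (sym (lookupB-∈ _ (Subst.distinct η) yt∈η)) x∈t

  module _ (Δ : Filter L) where

    OccursUnfiltered : ℕ → Atom L → Set
    OccursUnfiltered x (atom p ss) = ∃[ i ] Δ p i ≡ nothing × x ∈ᵥ lookup ss i

    occursUnfiltered? : ∀ x A → Dec (OccursUnfiltered x A)
    occursUnfiltered? x (atom p ss) =
      Fin.any? λ i → nothing? (Δ p i) ×-dec occursIn? x (lookup ss i)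

    occursUnfiltered⇒inVarAtom : ∀ {x A} → OccursUnfiltered x A → inVarAtom L x A
    occursUnfiltered⇒inVarAtom {A = atom p ss} (i , _ , x∈sᵢ) = i , x∈sᵢ

    atomMoreGeneralFor-cong : ∀ {η η′ A B} →
      (∀ y → OccursUnfiltered y A → var y ∙ η′ ≡ var y ∙ η) →
      AtomMoreGeneralFor L Δ η A B → AtomMoreGeneralFor L Δ η′ A B
    atomMoreGeneralFor-cong {η} {η′} agree (mg {p} {ss} {ts} cond) = mg position
      where
      position : ∀ i → PosCond L (Δ p i) (lookup ss i) (lookup ts i) η′
      position i with Δ p i in unfiltered | cond i
      ... | just _  | c = c
      ... | nothing | tᵢ≡sᵢη =
        trans tᵢ≡sᵢη (sym (∙-cong η η′ (lookup ss i) λ y y∈sᵢ → agree y (i , unfiltered , y∈sᵢ)))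

    queryMoreGeneralFor-cong : ∀ {η η′ Q Q′} →
      (∀ y → Any (OccursUnfiltered y) Q → var y ∙ η′ ≡ var y ∙ η) →
      QueryMoreGeneralFor L Δ η Q Q′ → QueryMoreGeneralFor L Δ η′ Q Q′
    queryMoreGeneralFor-cong agree []             = []
    queryMoreGeneralFor-cong agree (A≤B ∷ Q≤Q′) =
      atomMoreGeneralFor-cong (λ y → agree y ∘ here) A≤B
        ∷ queryMoreGeneralFor-cong (λ y → agree y ∘ there) Q≤Q′

    atomMoreGeneralFor-image : ∀ {η A B x y} → AtomMoreGeneralFor L Δ η A B →
      OccursUnfiltered y A → x ∈ᵥ (var y ∙ η) → inVarAtom L x B
    atomMoreGeneralFor-image {η} {x = x} (mg {ss = ss} {ts} cond) (i , unfiltered , y∈sᵢ) x∈yη =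
      i , subst (x ∈ᵥ_) (sym tᵢ≡sᵢη) (occursIn-∙ η y∈sᵢ x∈yη)
      where
      tᵢ≡sᵢη : lookup ts i ≡ lookup ss i ∙ η
      tᵢ≡sᵢη = subst (λ m → PosCond L m (lookup ss i) (lookup ts i) η) unfiltered (cond i)

    queryMoreGeneralFor-image : ∀ {η Q Q′ x y} → QueryMoreGeneralFor L Δ η Q Q′ →
      Any (OccursUnfiltered y) Q → x ∈ᵥ (var y ∙ η) → inVarQuery L x Q′
    queryMoreGeneralFor-image (A≤B ∷ _)  (here y∈A)  x∈yη =
      here (atomMoreGeneralFor-image A≤B y∈A x∈yη)
    queryMoreGeneralFor-image (_ ∷ Q≤Q′) (there y∈Q) x∈yη =
      there (queryMoreGeneralFor-image Q≤Q′ y∈Q x∈yη)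

proposition1 : (L : Language) (Δ : Filter L) (Q Q' : Query L) →
    QueryMoreGeneral L Δ Q Q' ⇔
    Σ (Subst L) (λ η →
      ((x : _) → inVarSubst L x η → inVarQuery L x Q ⊎ inVarQuery L x Q')
      × QueryMoreGeneralFor L Δ η Q Q')
proposition1 L Δ Q Q′ = mk⇔ restricted (λ (η , _ , Q≤Q′) → η , Q≤Q′)
  where
  unfiltered? : Decidable (λ x → Any (OccursUnfiltered Δ x) Q)
  unfiltered? x = Any.any? (occursUnfiltered? Δ x) Q

  restricted : QueryMoreGeneral L Δ Q Q′ →
    Σ (Subst L) (λ η →
      ((x : _) → inVarSubst L x η → inVarQuery L x Q ⊎ inVarQuery L x Q′)
      × QueryMoreGeneralFor L Δ η Q Q′)
  restricted (η , Q≤Q′) =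
    restrict unfiltered? η , vars , queryMoreGeneralFor-cong Δ (λ _ → restrict-agrees unfiltered? η) Q≤Q′
    where
    vars : ∀ x → inVarSubst L x (restrict unfiltered? η) → inVarQuery L x Q ⊎ inVarQuery L x Q′
    vars x (inj₁ x∈dom) =
      inj₁ (Any.map (λ {A} → occursUnfiltered⇒inVarAtom Δ {x} {A}) (restrict-dom unfiltered? η x∈dom))
    vars x (inj₂ x∈ran) with restrict-ran unfiltered? η x∈ran
    ... | y , y∈Q , x∈yη = inj₂ (queryMoreGeneralFor-image Δ Q≤Q′ y∈Q x∈yη)
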